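{- Let $\Gamma$ be a finite, simple, strongly connected digraph of order $n\geq 2$. Then $\dim(\Gamma)=n-1$ if and only if $\Gamma$ is complete.
   Context: $\partial(x,y)$ is the length of a shortest directed path from $x$ to $y$; $\tilde\partial(x,y)=(\partial(x,y),\partial(y,x))$. A vertex set $\{w_1,\dots,w_m\}$ is weakly resolving if $(\tilde\partial(w_1,u),\dots,\tilde\partial(w_m,u))\neq(\tilde\partial(w_1,v),\dots,\tilde\partial(w_m,v))$ for all distinct $u,v$; $\dim(\Gamma)$ (weak metric dimension) is the minimum size of such a set. A digraph is complete if every ordered pair of distinct vertices is an arc. -}

module Defs where

open import Data.Nat using (ℕ; zero; suc; _≤_; _∸_)
open import Data.Bool using (Bool; true; false; T)
open import Data.Fin using (Fin)
open import Data.Fin.Subset using (Subset; _∈_; ∣_∣)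
open import Data.Product using (Σ; ∃; ∃-syntax; _×_; _,_)
open import Data.Sum using (_⊎_)
open import Relation.Binary.PropositionalEquality using (_≡_; _≢_)

-- Simplicity: no loops
-- (multiple arcs are impossible in this representation).
record Digraph (n : ℕ) : Set where
  field
    adj      : Fin n → Fin n → Bool
    loopless : ∀ x → adj x x ≡ false

module _ {n : ℕ} (Γ : Digraph n) where
  open Digraph Γ

  Arc : Fin n → Fin n → Set
  Arc x y = T (adj x y)

  data Walk : Fin n → Fin n → ℕ → Set where
    nil  : ∀ {x} → Walk x x 0
    cons : ∀ {x y z k} → Arc x y → Walk y z k → Walk x z (suc k)

  StronglyConnected : Set
  StronglyConnected = ∀ x y → ∃[ k ] Walk x y k

  IsDist : Fin n → Fin n → ℕ → Set
  IsDist x y k = Walk x y k × (∀ j → Walk x y j → k ≤ j)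

  Distinguishes : Fin n → Fin n → Fin n → Set
  Distinguishes w u v =
      (∃[ k ] ∃[ k′ ] (IsDist w u k × IsDist w v k′ × k ≢ k′))
    ⊎ (∃[ k ] ∃[ k′ ] (IsDist u w k × IsDist v w k′ × k ≢ k′))

  WeaklyResolving : Subset n → Set
  WeaklyResolving W = ∀ u v → u ≢ v → ∃[ w ] (w ∈ W × Distinguishes w u v)

  WeakMetricDim : ℕ → Set
  WeakMetricDim d =
    (∃[ W ] (WeaklyResolving W × ∣ W ∣ ≡ d))
    × (∀ W → WeaklyResolving W → d ≤ ∣ W ∣)

  Complete : Set
  Complete = ∀ x y → x ≢ y → Arc x y

-- If two distinct vertices x, y are not joined by the arc (x , y), pick any
-- out-neighbour z of x. Every vertex is distinguished from any other by
-- itself, and x distinguishes z from y since ∂(x,z) = 1 ≠ ∂(x,y); so all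
-- vertices except z and y form a weakly resolving set of size n - 2.
-- Conversely, in a complete digraph every distance between distinct vertices
-- is 1, so a vertex only distinguishes pairs containing itself: a weakly
-- resolving set misses at most one vertex, and missing exactly one suffices.
module Submission where

open import Defs
open import Data.Nat using (ℕ; zero; suc; _≤_; _<_; _∸_; z≤n; s≤s)
open import Data.Nat.Properties
  using (≤-antisym; ≤-trans; ≮⇒≥; <⇒≱; m<1+n⇒m<n∨m≡n; m∸n≤m; n<1+n)
open import Data.Bool using (T)
open import Data.Fin using (Fin; zero; suc; _≟_)
open import Data.Fin.Properties using (any?; all?; ¬∀⟶∃¬)
open import Data.Fin.Subset using (Subset; _∈_; _∉_; ∣_∣; ⊤; _-_; _⊆_)
open import Data.Fin.Subset.Properties
  using (_∈?_; ∈⊤; x∈p∧x≢y⇒x∈p-y; x∈p⇒∣p-x∣<∣p∣; p⊆q⇒∣p∣≤∣q∣; p─⊥≡p; ∣⊤∣≡n)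
open import Data.Product using (∃; ∃-syntax; _×_; _,_; proj₂)
open import Data.Sum using (_⊎_; inj₁; inj₂)
open import Data.Vec using (_∷_; there)
open import Function.Bundles using (_⇔_; mk⇔)
open import Relation.Nullary using (Dec; yes; no; ¬_; contradiction)
open import Relation.Nullary.Decidable using (T?; map′; _×-dec_)
open import Relation.Unary using (Decidable)
open import Relation.Binary.PropositionalEquality
  using (_≡_; _≢_; refl; sym; trans; cong; subst; ≢-sym)

module _ {P : ℕ → Set} (P? : Decidable P) where

  Least : ℕ → Set
  Least m = P m × (∀ j → P j → m ≤ j)

  least-or-absentBelow : ∀ i → ∃ Least ⊎ (∀ j → j < i → ¬ P j)
  least-or-absentBelow zero = inj₂ (λ _ ())
  least-or-absentBelow (suc i) with least-or-absentBelow i | P? i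
  ... | inj₁ found | _      = inj₁ found
  ... | inj₂ none  | yes pi = inj₁ (i , pi , λ j pj → ≮⇒≥ (λ j<i → none j j<i pj))
  ... | inj₂ none  | no ¬pi = inj₂ λ j j<1+i → absent (m<1+n⇒m<n∨m≡n j<1+i)
    where
    absent : ∀ {j} → j < i ⊎ j ≡ i → ¬ P j
    absent (inj₁ j<i) = none _ j<i
    absent (inj₂ refl) = ¬pi

  least : ∀ {k} → P k → ∃ Least
  least {k} pk with least-or-absentBelow (suc k)
  ... | inj₁ found = found
  ... | inj₂ none  = contradiction pk (none k (n<1+n k))

x∉p-x : ∀ {n} (p : Subset n) (x : Fin n) → x ∉ p - x
x∉p-x (_ ∷ p) zero ()
x∉p-x (_ ∷ p) (suc x) (there x∈p-x) = x∉p-x p x x∈p-x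

x∉p-y⇒x∉p⊎x≡y : ∀ {n} {p : Subset n} {x y : Fin n} → x ∉ p - y → x ∉ p ⊎ x ≡ y
x∉p-y⇒x∉p⊎x≡y {x = x} {y} x∉p-y with x ≟ y
... | yes x≡y = inj₂ x≡y
... | no x≢y = inj₁ λ x∈p → x∉p-y (x∈p∧x≢y⇒x∈p-y x∈p x≢y)

x∉⊤-y⇒x≡y : ∀ {n} {x y : Fin n} → x ∉ ⊤ - y → x ≡ y
x∉⊤-y⇒x≡y x∉⊤-y with x∉p-y⇒x∉p⊎x≡y x∉⊤-y
... | inj₁ x∉⊤ = contradiction ∈⊤ x∉⊤
... | inj₂ x≡y = x≡y

x∉⊤-y-z⇒x≡y⊎x≡z : ∀ {n} {x y z : Fin n} → x ∉ ⊤ - y - z → x ≡ y ⊎ x ≡ z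
x∉⊤-y-z⇒x≡y⊎x≡z x∉⊤-y-z with x∉p-y⇒x∉p⊎x≡y x∉⊤-y-z
... | inj₁ x∉⊤-y = inj₁ (x∉⊤-y⇒x≡y x∉⊤-y)
... | inj₂ x≡z = inj₂ x≡z

∣⊤-x∣≡n∸1 : ∀ {n} (x : Fin n) → ∣ ⊤ - x ∣ ≡ n ∸ 1
∣⊤-x∣≡n∸1 {suc n} zero = trans (cong ∣_∣ (p─⊥≡p (⊤ {n}))) (∣⊤∣≡n n)
∣⊤-x∣≡n∸1 {suc (suc n)} (suc x) = cong suc (∣⊤-x∣≡n∸1 x)

n∸1≤∣p∣ : ∀ {n} (p : Subset n) → (∀ {x y} → x ∉ p → y ∉ p → x ≡ y) → n ∸ 1 ≤ ∣ p ∣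
n∸1≤∣p∣ {n} p missesAtMostOne with all? (_∈? p)
... | yes ∀∈p = ≤-trans (m∸n≤m n 1) (subst (_≤ ∣ p ∣) (∣⊤∣≡n n) (p⊆q⇒∣p∣≤∣q∣ {p = ⊤} λ {x} _ → ∀∈p x))
... | no ¬∀∈p with ¬∀⟶∃¬ n (_∈ p) (_∈? p) ¬∀∈p
...   | x , x∉p = subst (_≤ ∣ p ∣) (∣⊤-x∣≡n∸1 x) (p⊆q⇒∣p∣≤∣q∣ ⊤-x⊆p)
  where
  ⊤-x⊆p : ⊤ - x ⊆ p
  ⊤-x⊆p {y} y∈⊤-x with y ∈? p
  ... | yes y∈p = y∈p
  ... | no y∉p = contradiction (subst (λ z → y ∈ ⊤ - z) (sym (missesAtMostOne y∉p x∉p)) y∈⊤-x)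
                               (x∉p-x ⊤ y)

module _ {n : ℕ} (Γ : Digraph n) where
  open Digraph Γ

  arc? : ∀ x y → Dec (Arc Γ x y)
  arc? x y = T? (adj x y)

  arc⇒≢ : ∀ {x y} → Arc Γ x y → x ≢ y
  arc⇒≢ {x} a refl = subst T (loopless x) a

  walk₀⇒≡ : ∀ {x y} → Walk Γ x y 0 → x ≡ y
  walk₀⇒≡ nil = refl

  walk₁⇒arc : ∀ {x y} → Walk Γ x y 1 → Arc Γ x y
  walk₁⇒arc (cons a nil) = a

  walk⇒outNeighbour : ∀ {x y k} → Walk Γ x y k → x ≢ y → ∃[ z ] Arc Γ x z
  walk⇒outNeighbour nil x≢x = contradiction refl x≢x
  walk⇒outNeighbour (cons a _) _ = _ , a

  walk? : ∀ k x y → Dec (Walk Γ x y k)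
  walk? zero x y = map′ (λ { refl → nil }) walk₀⇒≡ (x ≟ y)
  walk? (suc k) x y =
    map′ (λ { (_ , a , w) → cons a w }) (λ { (cons a w) → _ , a , w })
         (any? λ z → arc? x z ×-dec walk? k z y)

  IsDist-unique : ∀ {x y k m} → IsDist Γ x y k → IsDist Γ x y m → k ≡ m
  IsDist-unique (wk , k≤) (wm , m≤) = ≤-antisym (k≤ _ wm) (m≤ _ wk)

  IsDist-refl : ∀ x → IsDist Γ x x 0
  IsDist-refl x = nil , λ _ _ → z≤n

  IsDist⇒≢0 : ∀ {x y k} → x ≢ y → IsDist Γ x y k → k ≢ 0
  IsDist⇒≢0 x≢y (w , _) refl = x≢y (walk₀⇒≡ w)

  IsDist⇒≢1 : ∀ {x y k} → ¬ Arc Γ x y → IsDist Γ x y k → k ≢ 1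
  IsDist⇒≢1 ¬a (w , _) refl = ¬a (walk₁⇒arc w)

  arc⇒IsDist₁ : ∀ {x y} → Arc Γ x y → IsDist Γ x y 1
  arc⇒IsDist₁ a = cons a nil , λ
    { zero w → contradiction (walk₀⇒≡ w) (arc⇒≢ a)
    ; (suc _) _ → s≤s z≤n }

  Distinguishes-sym : ∀ {w u v} → Distinguishes Γ w u v → Distinguishes Γ w v u
  Distinguishes-sym (inj₁ (k , k′ , du , dv , k≢k′)) = inj₁ (k′ , k , dv , du , ≢-sym k≢k′)
  Distinguishes-sym (inj₂ (k , k′ , du , dv , k≢k′)) = inj₂ (k′ , k , dv , du , ≢-sym k≢k′)

  Complete⇒¬Distinguishes : Complete Γ → ∀ {w u v} → w ≢ u → w ≢ v →
                            ¬ Distinguishes Γ w u v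
  Complete⇒¬Distinguishes c w≢u w≢v (inj₁ (_ , _ , du , dv , k≢k′)) =
    k≢k′ (trans (IsDist-unique du (arc⇒IsDist₁ (c _ _ w≢u)))
                (IsDist-unique (arc⇒IsDist₁ (c _ _ w≢v)) dv))
  Complete⇒¬Distinguishes c w≢u w≢v (inj₂ (_ , _ , du , dv , k≢k′)) =
    k≢k′ (trans (IsDist-unique du (arc⇒IsDist₁ (c _ _ (≢-sym w≢u))))
                (IsDist-unique (arc⇒IsDist₁ (c _ _ (≢-sym w≢v))) dv))

  Complete⇒resolvingMissesAtMostOne : Complete Γ → ∀ {W} → WeaklyResolving Γ W →
                                      ∀ {u v} → u ∉ W → v ∉ W → u ≡ v
  Complete⇒resolvingMissesAtMostOne c res {u} {v} u∉W v∉W with u ≟ v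
  ... | yes u≡v = u≡v
  ... | no u≢v with res u v u≢v
  ...   | w , w∈W , dist = contradiction dist (Complete⇒¬Distinguishes c w≢u w≢v)
    where
    w≢u : w ≢ u
    w≢u refl = u∉W w∈W
    w≢v : w ≢ v
    w≢v refl = v∉W w∈W

  module _ (sc : StronglyConnected Γ) where

    dist : ∀ x y → ∃[ k ] IsDist Γ x y k
    dist x y = least (λ k → walk? k x y) (proj₂ (sc x y))

    Distinguishes-self : ∀ {u v} → u ≢ v → Distinguishes Γ u u v
    Distinguishes-self {u} {v} u≢v with dist u v
    ... | k , d = inj₁ (0 , k , IsDist-refl u , d , ≢-sym (IsDist⇒≢0 u≢v d))

    outNeighbour-distinguished : ∀ {x y z} → Arc Γ x z → ¬ Arc Γ x y →
                                 Distinguishes Γ x z y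
    outNeighbour-distinguished {x} {y} a ¬a with dist x y
    ... | k , d = inj₁ (1 , k , arc⇒IsDist₁ a , d , ≢-sym (IsDist⇒≢1 ¬a d))

    weaklyResolving-outside : ∀ {W} →
      (∀ {u v} → u ≢ v → u ∉ W → v ∉ W → ∃[ w ] (w ∈ W × Distinguishes Γ w u v)) →
      WeaklyResolving Γ W
    weaklyResolving-outside {W} pairs u v u≢v with u ∈? W | v ∈? W
    ... | yes u∈W | _       = u , u∈W , Distinguishes-self u≢v
    ... | no _    | yes v∈W = v , v∈W , Distinguishes-sym (Distinguishes-self (≢-sym u≢v))
    ... | no u∉W  | no v∉W  = pairs u≢v u∉W v∉W

    weaklyResolving-⊤-x : ∀ x → WeaklyResolving Γ (⊤ - x)
    weaklyResolving-⊤-x x = weaklyResolving-outside λ u≢v u∉ v∉ →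
      contradiction (trans (x∉⊤-y⇒x≡y u∉) (sym (x∉⊤-y⇒x≡y v∉))) u≢v

    ¬arc⇒smallResolvingSet : ∀ {x y} → x ≢ y → ¬ Arc Γ x y →
                              ∃[ W ] (WeaklyResolving Γ W × ∣ W ∣ < n ∸ 1)
    ¬arc⇒smallResolvingSet {x} {y} x≢y ¬a with walk⇒outNeighbour (proj₂ (sc x y)) x≢y
    ... | z , a = ⊤ - z - y , weaklyResolving-outside pairs , smaller
      where
      z≢y : z ≢ y
      z≢y refl = ¬a a

      x∈W : x ∈ ⊤ - z - y
      x∈W = x∈p∧x≢y⇒x∈p-y (x∈p∧x≢y⇒x∈p-y ∈⊤ (arc⇒≢ a)) x≢y

      smaller : ∣ ⊤ - z - y ∣ < n ∸ 1
      smaller = subst (∣ ⊤ - z - y ∣ <_) (∣⊤-x∣≡n∸1 z)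
                      (x∈p⇒∣p-x∣<∣p∣ (x∈p∧x≢y⇒x∈p-y ∈⊤ (≢-sym z≢y)))

      pairs : ∀ {u v} → u ≢ v → u ∉ ⊤ - z - y → v ∉ ⊤ - z - y →
                ∃[ w ] (w ∈ ⊤ - z - y × Distinguishes Γ w u v)
      pairs {u} {v} u≢v u∉ v∉ with x∉⊤-y-z⇒x≡y⊎x≡z u∉ | x∉⊤-y-z⇒x≡y⊎x≡z v∉
      ... | inj₁ refl | inj₂ refl = x , x∈W , outNeighbour-distinguished a ¬a
      ... | inj₂ refl | inj₁ refl = x , x∈W , Distinguishes-sym (outNeighbour-distinguished a ¬a)
      ... | inj₁ refl | inj₁ refl = contradiction refl u≢v
      ... | inj₂ refl | inj₂ refl = contradiction refl u≢v

corollary2p2 : ∀ (n : ℕ) → 2 ≤ n → (Γ : Digraph n) → StronglyConnected Γ →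
    WeakMetricDim Γ (n ∸ 1) ⇔ Complete Γ
corollary2p2 (suc n) _ Γ sc = mk⇔ dim⇒complete complete⇒dim
  where
  dim⇒complete : WeakMetricDim Γ n → Complete Γ
  dim⇒complete (_ , minimal) x y x≢y with arc? Γ x y
  ... | yes a = a
  ... | no ¬a with ¬arc⇒smallResolvingSet Γ sc x≢y ¬a
  ...   | W , res , small = contradiction (minimal W res) (<⇒≱ small)

  complete⇒dim : Complete Γ → WeakMetricDim Γ n
  complete⇒dim c = (⊤ - zero , weaklyResolving-⊤-x Γ sc zero , ∣⊤-x∣≡n∸1 zero)
                 , λ W res → n∸1≤∣p∣ W (Complete⇒resolvingMissesAtMostOne Γ c res)
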